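{- Let $s$ be a reachable state of the Set EXAM to which no overhead transition applies. If $\mathrm{rb}(s)\to_{\mathtt{ext}}u$, then there exists $s'$ such that $s\to_\beta s'$ and $\mathrm{rb}(s')=u$.
   Context: $\lambda$-terms $t ::= x\mid\lambda x.t\mid t\,t$ (modulo $\alpha$ as terms, pre-terms inside states); $t\{x:=u\}$ capture-avoiding substitution; root $\beta$: $(\lambda x.t)\,u\mapsto t\{x:=u\}$. Rigid terms $r ::= x\mid r\,t$; rigid contexts $S ::= \langle\cdot\rangle\mid r\,B\mid S\,t$; external contexts $B ::= S\mid\lambda x.B$; $B\langle t\rangle\to_{\mathtt{ext}}B\langle u\rangle$ whenever $t\mapsto u$ by root $\beta$. A pre-term is well-named if its bound variables are pairwise distinct. Stacks $S ::= \epsilon\mid t:S$. Environments $E ::= \epsilon\mid[x\leftarrow t]:E$; $\mathrm{dom}(E)$, $E(x)$ the pre-term of the (leftmost) entry for $x$. Named multi-contexts $\mathbb{C} ::= x\mid\langle\cdot\rangle_\alpha\mid\lambda x.\mathbb{C}\mid\mathbb{C}\,\mathbb{C}$; $\mathbb{C}\{\alpha\leftarrow\mathbb{C}'\}$ capture-allowing replacement. Approximants $\mathbb{B} ::= \langle\cdot\rangle_\alpha\mid\mathbb{R}\mid\lambda x.\mathbb{B}$, $\mathbb{R} ::= x\mid\mathbb{R}\,\mathbb{B}$. Jobs $(t,S)_\alpha$. Set EXAM: states $(\mathbb{B},P,E)$ with $P$ a finite set of jobs with pairwise distinct names; initialization $t\triangleright(\langle\cdot\rangle_\alpha,\{(t',\epsilon)_\alpha\},\epsilon)$,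 $t'$ well-named and $\alpha$-equivalent to $t$. A transition selects any $j_\alpha\in P$, $P'=P\setminus\{j_\alpha\}$: ($\mathtt{sea}_@$) $(t\,u,S)_\alpha\Rightarrow(\mathbb{B},P'\cup\{(t,u:S)_\alpha\},E)$; ($\beta$) $(\lambda x.t,u:S)_\alpha\Rightarrow(\mathbb{B},P'\cup\{(t,S)_\alpha\},[x\leftarrow u]:E)$; ($\mathtt{sub}$) $(x,S)_\alpha$ with $x\in\mathrm{dom}(E)\Rightarrow(\mathbb{B},P'\cup\{(t',S)_\alpha\},E)$, $t'$ a fresh well-named renaming of $E(x)$; ($\mathtt{sea}_\lambda$) $(\lambda x.t,\epsilon)_\alpha\Rightarrow(\mathbb{B}\{\alpha\leftarrow\lambda x.\langle\cdot\rangle_\alpha\},P'\cup\{(t,\epsilon)_\alpha\},E)$; ($\mathtt{sea}_{\mathcal V}$) $(x,t_1:\dots:t_n)_\alpha$ with $n\ge0$, $x\notin\mathrm{dom}(E)\Rightarrow(\mathbb{B}\{\alpha\leftarrow x\,\langle\cdot\rangle_{\beta_1}\cdots\langle\cdot\rangle_{\beta_n}\},P'\cup\{(t_1,\epsilon)_{\beta_1},\dots,(t_n,\epsilon)_{\beta_n}\},E)$, fresh $\beta_i$. Overhead transitions: $\mathtt{sea}_@$, $\mathtt{sub}$, $\mathtt{sea}_\lambda$, $\mathtt{sea}_{\mathcal V}$; $\to_\beta$ is the $\beta$ transition. Reachable states are those obtained from initial states by finitely many transitions. Read-back: $t\downarrow\epsilon:=t$, $t\downarrow([x\leftarrow u]:E):=(t\{x:=u\})\downarrow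 E$; stacks pointwise; $\langle t\mid\epsilon\rangle:=t$, $\langle t\mid u:S\rangle:=\langle t\,u\mid S\rangle$; $(t,S)_\alpha\downarrow E:=(t\downarrow E,S\downarrow E)_\alpha$, lifted to sets; $\mathrm{rb}((t,S)_\alpha):=\langle t\mid S\rangle$; $\mathbb{C}_X:=\mathbb{C}\{\alpha_1\leftarrow\mathrm{rb}(j_{\alpha_1})\}\cdots\{\alpha_n\leftarrow\mathrm{rb}(j_{\alpha_n})\}$; $\mathrm{rb}((\mathbb{B},P,E)):=\mathbb{B}_{P\downarrow E}$.
   Formalization: A well-named pre-term has its bound variables pairwise distinct and also distinct from its free variables, both for the pre-term t' of an initial state and for the renamings in the sub transition. Apart from conventions, each condition added here is assumed in the paper as well or is needed for the statement above to hold. -}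

module Defs where

open import Data.Nat using (ℕ; zero; suc; _+_; _∸_; _<ᵇ_; _≡ᵇ_; pred)
open import Data.Bool using (if_then_else_)
open import Data.List using (List; []; _∷_; _++_; map; foldl; zipWith; length)
open import Data.List.Relation.Unary.All using (All)
open import Data.List.Relation.Unary.Unique.Propositional using (Unique)
open import Data.List.Membership.Propositional using (_∈_; _∉_)
open import Data.Maybe using (Maybe; just; nothing)
open import Data.Product using (_×_; _,_; ∃)
open import Relation.Binary.PropositionalEquality using (_≡_; _≢_)
open import Relation.Binary.Construct.Closure.ReflexiveTransitive using (Star)
open import Relation.Nullary using (¬_)

-- λ-terms modulo α: de Bruijn terms.  Convention: at depth d (under d
-- binders) an index i ≥ d denotes the FREE variable named (i ∸ d).
-- So closed-under-nothing de Bruijn terms at depth 0 are exactly the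
-- α-classes of named terms over variable names ℕ.

Name : Set
Name = ℕ

data Tm : Set where
  var : ℕ → Tm
  lam : Tm → Tm
  app : Tm → Tm → Tm

shiftFrom : ℕ → ℕ → Tm → Tm
shiftFrom c k (var i) = if i <ᵇ c then var i else var (k + i)
shiftFrom c k (lam t) = lam (shiftFrom (suc c) k t)
shiftFrom c k (app t u) = app (shiftFrom c k t) (shiftFrom c k u)

substB : ℕ → Tm → Tm → Tm
substB d u (var i) = if i <ᵇ d then var i else (if i ≡ᵇ d then shiftFrom 0 d u else var (pred i))
substB d u (lam t) = lam (substB (suc d) u t)
substB d u (app t t') = app (substB d u t) (substB d u t')

substN : Name → ℕ → Tm → Tm → Tm
substN x d u (var i) = if i <ᵇ d then var i else (if (i ∸ d) ≡ᵇ x then shiftFrom 0 d u else var i)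
substN x d u (lam t) = lam (substN x (suc d) u t)
substN x d u (app t t') = app (substN x d u t) (substN x d u t')

_[_≔_] : Tm → Name → Tm → Tm
t [ x ≔ u ] = substN x 0 u t

-- capture-allowing abstraction: λx.M where free x of M gets bound
close : Name → ℕ → Tm → Tm
close x d (var i) = if i <ᵇ d then var i else (if (i ∸ d) ≡ᵇ x then var d else var (suc i))
close x d (lam t) = lam (close x (suc d) t)
close x d (app t u) = app (close x d t) (close x d u)

data _↦β_ : Tm → Tm → Set where
  root : ∀ t u → app (lam t) u ↦β substB 0 u t

data Rigid : Tm → Set where
  rvar : ∀ i → Rigid (var i)
  rapp : ∀ {r} → Rigid r → ∀ t → Rigid (app r t)

mutual
  data RCtx : Set where
    hole : RCtx
    rigB : (r : Tm) → Rigid r → ECtx → RCtx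
    rApp : RCtx → Tm → RCtx

  data ECtx : Set where
    eR : RCtx → ECtx
    eLam : ECtx → ECtx

mutual
  plugR : RCtx → Tm → Tm
  plugR hole t = t
  plugR (rigB r _ B) t = app r (plugE B t)
  plugR (rApp S u) t = app (plugR S t) u

  plugE : ECtx → Tm → Tm
  plugE (eR S) t = plugR S t
  plugE (eLam B) t = lam (plugE B t)

data _→ext_ : Tm → Tm → Set where
  ext : ∀ (B : ECtx) {t u} → t ↦β u → plugE B t →ext plugE B u

data PTm : Set where
  v : Name → PTm
  ƛ : Name → PTm → PTm
  _·_ : PTm → PTm → PTm

-- α-class of a pre-term (relative to a list of enclosing binders)
lookupIdx : List Name → Name → ℕ
lookupIdx [] x = x
lookupIdx (y ∷ Γ) x = if x ≡ᵇ y then 0 else suc (lookupIdx Γ x)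

conv : List Name → PTm → Tm
conv Γ (v x) = var (lookupIdx Γ x)
conv Γ (ƛ x t) = lam (conv (x ∷ Γ) t)
conv Γ (t · u) = app (conv Γ t) (conv Γ u)

⟦_⟧ : PTm → Tm
⟦ t ⟧ = conv [] t

names : PTm → List Name
names (v x) = x ∷ []
names (ƛ x t) = x ∷ names t
names (t · u) = names t ++ names u

bv : PTm → List Name
bv (v x) = []
bv (ƛ x t) = x ∷ bv t
bv (t · u) = bv t ++ bv u

data FreeIn (x : Name) : PTm → Set where
  fv-var : FreeIn x (v x)
  fv-lam : ∀ {y t} → x ≢ y → FreeIn x t → FreeIn x (ƛ y t)
  fv-appl : ∀ {t u} → FreeIn x t → FreeIn x (t · u)
  fv-appr : ∀ {t u} → FreeIn x u → FreeIn x (t · u)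

WellNamed : PTm → Set
WellNamed t = Unique (bv t) × (∀ x → x ∈ bv t → ¬ FreeIn x t)

JName : Set
JName = ℕ

Stack : Set
Stack = List PTm

Env : Set
Env = List (Name × PTm)

lookupEnv : Env → Name → Maybe PTm
lookupEnv [] x = nothing
lookupEnv ((y , t) ∷ E) x = if x ≡ᵇ y then just t else lookupEnv E x

data MC : Set where
  mv : Name → MC
  mhole : JName → MC
  mlam : Name → MC → MC
  mapp : MC → MC → MC

_⟪_←_⟫ : MC → JName → MC → MC
mv x ⟪ α ← C' ⟫ = mv x
mhole β ⟪ α ← C' ⟫ = if β ≡ᵇ α then C' else mhole β
mlam x C ⟪ α ← C' ⟫ = mlam x (C ⟪ α ← C' ⟫)
mapp C D ⟪ α ← C' ⟫ = mapp (C ⟪ α ← C' ⟫) (D ⟪ α ← C' ⟫)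

mcNames : MC → List Name
mcNames (mv x) = x ∷ []
mcNames (mhole _) = []
mcNames (mlam x C) = x ∷ mcNames C
mcNames (mapp C D) = mcNames C ++ mcNames D

mcHoles : MC → List JName
mcHoles (mv x) = []
mcHoles (mhole α) = α ∷ []
mcHoles (mlam x C) = mcHoles C
mcHoles (mapp C D) = mcHoles C ++ mcHoles D

record Job : Set where
  constructor job
  field
    tm : PTm
    stk : Stack
    nm : JName

record State : Set where
  constructor st
  field
    appr : MC
    jobs : List Job
    env : Env

concatL : ∀ {A : Set} → List (List A) → List A
concatL [] = []
concatL (xs ∷ xss) = xs ++ concatL xss

jobNamesOcc : Job → List Name
jobNamesOcc (job t S _) = names t ++ concatL (map names S)

envNames : Env → List Name
envNames [] = []
envNames ((x , t) ∷ E) = x ∷ names t ++ envNames E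

stateNames : State → List Name
stateNames (st B P E) = mcNames B ++ concatL (map jobNamesOcc P) ++ envNames E

stateJobNames : State → List JName
stateJobNames (st B P E) = mcHoles B ++ map Job.nm P

FreshFor : PTm → State → Set
FreshFor t s = All (λ y → y ∉ stateNames s) (bv t)

varCtx : Name → List JName → MC
varCtx x βs = foldl (λ C β → mapp C (mhole β)) (mv x) βs

data Kind : Set where
  kSeaApp kBeta kSub kSeaLam kSeaVar : Kind

Overhead : Kind → Set
Overhead k = k ≢ kBeta

data _⇒[_]_ : State → Kind → State → Set where
  t-seaApp : ∀ {B P₁ P₂ E t u S α} →
    st B (P₁ ++ job (t · u) S α ∷ P₂) E ⇒[ kSeaApp ] st B (P₁ ++ job t (u ∷ S) α ∷ P₂) E
  t-beta : ∀ {B P₁ P₂ E x t u S α} →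
    st B (P₁ ++ job (ƛ x t) (u ∷ S) α ∷ P₂) E ⇒[ kBeta ] st B (P₁ ++ job t S α ∷ P₂) ((x , u) ∷ E)
  t-sub : ∀ {B P₁ P₂ E x S α t₀ t'} →
    lookupEnv E x ≡ just t₀ →
    WellNamed t' → ⟦ t' ⟧ ≡ ⟦ t₀ ⟧ →
    FreshFor t' (st B (P₁ ++ job (v x) S α ∷ P₂) E) →
    st B (P₁ ++ job (v x) S α ∷ P₂) E ⇒[ kSub ] st B (P₁ ++ job t' S α ∷ P₂) E
  t-seaLam : ∀ {B P₁ P₂ E x t α} →
    st B (P₁ ++ job (ƛ x t) [] α ∷ P₂) E ⇒[ kSeaLam ]
      st (B ⟪ α ← mlam x (mhole α) ⟫) (P₁ ++ job t [] α ∷ P₂) E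
  t-seaVar : ∀ {B P₁ P₂ E x S α} (βs : List JName) →
    lookupEnv E x ≡ nothing →
    length βs ≡ length S → Unique βs →
    All (λ β → β ∉ stateJobNames (st B (P₁ ++ job (v x) S α ∷ P₂) E)) βs →
    st B (P₁ ++ job (v x) S α ∷ P₂) E ⇒[ kSeaVar ]
      st (B ⟪ α ← varCtx x βs ⟫) (P₁ ++ zipWith (λ t β → job t [] β) S βs ++ P₂) E

AnyStep : State → State → Set
AnyStep s s' = ∃ λ k → s ⇒[ k ] s'

Reachable : State → Set
Reachable s = ∃ λ t' → ∃ λ (α : JName) →
  WellNamed t' × Star AnyStep (st (mhole α) (job t' [] α ∷ []) []) s

downTm : Tm → Env → Tm
downTm M [] = M
downTm M ((x , u) ∷ E) = downTm (M [ x ≔ ⟦ u ⟧ ]) E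

plugStack : Tm → List Tm → Tm
plugStack t S = foldl app t S

rbJob : Env → Job → Tm
rbJob E (job t S _) = plugStack (downTm ⟦ t ⟧ E) (map (λ u → downTm ⟦ u ⟧ E) S)

lookupJob : Env → List Job → JName → Maybe Tm
lookupJob E [] α = nothing
lookupJob E (j ∷ P) α = if Job.nm j ≡ᵇ α then just (rbJob E j) else lookupJob E P α

-- C_X: replace every hole by the read-back of its job (capture-allowing);
-- nothing if some hole has no job (C_X not a term)
fill : (JName → Maybe Tm) → MC → Maybe Tm
fill f (mv x) = just (var x)
fill f (mhole α) = f α
fill f (mlam x C) with fill f C
... | just M = just (lam (close x 0 M))
... | nothing = nothing
fill f (mapp C D) with fill f C | fill f D
... | just M | just N = just (app M N)
... | _ | _ = nothing

rb : State → Maybe Tm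
rb (st B P E) = fill (lookupJob E P) B

-- Two invariants of reachable states carry the argument. First, the approximant is built from
-- holes, abstractions and rigid applications only, with pairwise distinct hole names. External
-- contexts descend exactly through abstractions and rigid applications, and through the
-- capture-allowing abstractions of the approximant because closing a name maps redexes to
-- redexes; so an external step of the read-back is a step inside the read-back of one job α.
-- Second, the bound names of the jobs are pairwise distinct and occur free in no job and no
-- environment entry.
-- If no overhead transition applies, job α is (λx.t, u:S): any other shape enables sea@, seaλ,
-- sub (a fresh well-named renaming always exists) or seaV (fresh job names always exist). Its
-- read-back is the head redex (λx.t↓E)(u↓E)(S↓E), whose only external reduct is the read-back
-- of (t, S) under [x←u]:E. Since x is bound in job α, it is free in no other job, so the β
-- transition leaves the read-back of every other job unchanged.

module Submission where

open import Defs
open import Data.Maybe using (just)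
open import Data.Product using (_×_; ∃)
open import Relation.Binary.PropositionalEquality using (_≡_)
open import Relation.Nullary using (¬_)
open import Data.Bool using (true; false; if_then_else_; T)
open import Data.Bool.Properties using (T-≡)
open import Data.Empty using (⊥; ⊥-elim)
open import Data.List using (List; []; _∷_; _++_; map; concatMap; foldl; zipWith; length)
open import Data.List.Extrema.Nat using (max; xs≤max)
open import Data.List.Membership.Propositional using (_∈_; _∉_; find)
open import Data.List.Membership.Propositional.Properties using (∈-++⁺ˡ; ∈-++⁺ʳ; ∈-++⁻; ∈-concatMap⁻)
open import Data.List.Properties using (++-assoc; ++-identityʳ; concatMap-++; map-cong-local)
open import Data.List.Relation.Binary.Disjoint.Propositional using (Disjoint)
import Data.List.Relation.Binary.Permutation.Propositional as ↭
open import Data.List.Relation.Binary.Permutation.Propositional using (_↭_; ↭-sym; ↭-trans; ↭-reflexive; ↭⇒↭ₛ)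
open import Data.List.Relation.Binary.Permutation.Propositional.Properties using (∈-resp-↭; ++⁺ˡ; ++⁺ʳ; shift; shifts)
import Data.List.Relation.Binary.Permutation.Setoid.Properties as Permutationₛ
open import Data.List.Relation.Unary.All as All using (All; []; _∷_)
import Data.List.Relation.Unary.All.Properties as All
open import Data.List.Relation.Unary.AllPairs using ([]; _∷_)
open import Data.List.Relation.Unary.Any using (here; there)
open import Data.List.Relation.Unary.Unique.Propositional using (Unique)
import Data.List.Relation.Unary.Unique.Propositional.Properties as Unique
open import Data.Maybe using (Maybe; nothing)
open import Data.Maybe.Properties using (just-injective)
open import Data.Nat using (ℕ; zero; suc; _+_; _∸_; _<ᵇ_; _≡ᵇ_; pred; _<_; _≤_; z<s; s<s; s≤s)
open import Data.Nat.Properties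
open import Data.Nat.Tactic.RingSolver using (solve-∀)
open import Data.Product using (_,_; proj₁; proj₂)
open import Data.Sum using (_⊎_; inj₁; inj₂)
open import Data.Unit using (tt)
open import Function using (_∘_; _⇔_; mk⇔; Equivalence)
open import Relation.Binary.Construct.Closure.ReflexiveTransitive using (Star; ε; _◅_)
open import Relation.Binary.PropositionalEquality
open import Relation.Nullary using (yes; no; contradiction)

Unique-++⁻ : ∀ {A : Set} (xs : List A) {ys} → Unique (xs ++ ys) → Unique xs × Unique ys × Disjoint xs ys
Unique-++⁻ [] u = [] , u , λ ()
Unique-++⁻ (x ∷ xs) (x∉ ∷ u) with Unique-++⁻ xs u
... | uxs , uys , xs#ys = All.++⁻ˡ xs x∉ ∷ uxs , uys , λ
  { (here refl , q) → All.lookup (All.++⁻ʳ xs x∉) q refl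
  ; (there p , q) → xs#ys (p , q) }

concatMap-↭ : ∀ {A B : Set} (f : A → List B) {xs ys} → xs ↭ ys → concatMap f xs ↭ concatMap f ys
concatMap-↭ f ↭.refl = ↭.refl
concatMap-↭ f (↭.prep x p) = ++⁺ˡ (f x) (concatMap-↭ f p)
concatMap-↭ f (↭.swap x y p) = ↭-trans (shifts (f x) (f y)) (++⁺ˡ (f y) (++⁺ˡ (f x) (concatMap-↭ f p)))
concatMap-↭ f (↭.trans p q) = ↭-trans (concatMap-↭ f p) (concatMap-↭ f q)

Unique-resp-↭ : ∀ {A : Set} {xs ys : List A} → xs ↭ ys → Unique xs → Unique ys
Unique-resp-↭ p = Permutationₛ.Unique-resp-↭ (setoid _) (↭⇒↭ₛ p)

Unique-drop-middle : ∀ {A : Set} (xs ys : List A) {zs} → Unique (xs ++ ys ++ zs) → Unique (xs ++ zs)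
Unique-drop-middle xs ys u with Unique-++⁻ xs u
... | uxs , uyzs , xs#yzs with Unique-++⁻ ys uyzs
...   | _ , uzs , _ = Unique.++⁺ uxs uzs (λ (p , q) → xs#yzs (p , ∈-++⁺ʳ ys q))

∈-insert-middle : ∀ {A : Set} {y : A} xs ys {zs} → y ∈ xs ++ zs → y ∈ xs ++ ys ++ zs
∈-insert-middle xs ys p with ∈-++⁻ xs p
... | inj₁ q = ∈-++⁺ˡ q
... | inj₂ q = ∈-++⁺ʳ xs (∈-++⁺ʳ ys q)

¬T⇒≡false : ∀ {b} → ¬ T b → b ≡ false
¬T⇒≡false {false} _ = refl
¬T⇒≡false {true} ¬t = contradiction tt ¬t

<ᵇ-true : ∀ {m n} → m < n → (m <ᵇ n) ≡ true
<ᵇ-true m<n = Equivalence.to T-≡ (<⇒<ᵇ m<n)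

<ᵇ-false : ∀ {m n} → n ≤ m → (m <ᵇ n) ≡ false
<ᵇ-false n≤m = ¬T⇒≡false (λ t → <⇒≱ (<ᵇ⇒< _ _ t) n≤m)

≡ᵇ-refl : ∀ n → (n ≡ᵇ n) ≡ true
≡ᵇ-refl n = Equivalence.to T-≡ (≡⇒≡ᵇ n n refl)

≡ᵇ-false : ∀ {m n} → m ≢ n → (m ≡ᵇ n) ≡ false
≡ᵇ-false m≢n = ¬T⇒≡false (m≢n ∘ ≡ᵇ⇒≡ _ _)

data Cut (d : ℕ) : ℕ → Set where
  below : ∀ {i} → i < d → Cut d i
  above : ∀ j → Cut d (d + j)

cut : ∀ d i → Cut d i
cut zero i = above i
cut (suc d) zero = below z<s
cut (suc d) (suc i) with cut d i
... | below i<d = below (s<s i<d)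
... | above j = above j

data Cut₃ (d : ℕ) : ℕ → Set where
  below : ∀ {i} → i < d → Cut₃ d i
  at : Cut₃ d d
  above : ∀ j → Cut₃ d (suc (d + j))

cut₃ : ∀ d i → Cut₃ d i
cut₃ d i with cut d i
... | below i<d = below i<d
... | above zero rewrite +-identityʳ d = at
... | above (suc j) rewrite +-suc d j = above j

module _ {c k i : ℕ} where

  shiftFrom-below : i < c → shiftFrom c k (var i) ≡ var i
  shiftFrom-below i<c rewrite <ᵇ-true i<c = refl

  shiftFrom-above : c ≤ i → shiftFrom c k (var i) ≡ var (k + i)
  shiftFrom-above c≤i rewrite <ᵇ-false c≤i = refl

module _ {d : ℕ} {u : Tm} where

  substB-below : ∀ {i} → i < d → substB d u (var i) ≡ var i
  substB-below i<d rewrite <ᵇ-true i<d = refl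

  substB-at : substB d u (var d) ≡ shiftFrom 0 d u
  substB-at rewrite <ᵇ-false (≤-refl {d}) | ≡ᵇ-refl d = refl

  substB-above : ∀ {i} → d < i → substB d u (var i) ≡ var (pred i)
  substB-above d<i rewrite <ᵇ-false (<⇒≤ d<i) | ≡ᵇ-false (≢-sym (<⇒≢ d<i)) = refl

module _ {x d : ℕ} where

  substN-below : ∀ {u i} → i < d → substN x d u (var i) ≡ var i
  substN-below i<d rewrite <ᵇ-true i<d = refl

  substN-hit : ∀ {u i} → i ≡ d + x → substN x d u (var i) ≡ shiftFrom 0 d u
  substN-hit refl rewrite <ᵇ-false (m≤m+n d x) | m+n∸m≡n d x | ≡ᵇ-refl x = refl

  substN-miss : ∀ {u i j} → i ≡ d + j → j ≢ x → substN x d u (var i) ≡ var i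
  substN-miss {j = j} refl j≢x rewrite <ᵇ-false (m≤m+n d j) | m+n∸m≡n d j | ≡ᵇ-false j≢x = refl

  close-below : ∀ {i} → i < d → close x d (var i) ≡ var i
  close-below i<d rewrite <ᵇ-true i<d = refl

  close-hit : ∀ {i} → i ≡ d + x → close x d (var i) ≡ var d
  close-hit refl rewrite <ᵇ-false (m≤m+n d x) | m+n∸m≡n d x | ≡ᵇ-refl x = refl

  close-miss : ∀ {i j} → i ≡ d + j → j ≢ x → close x d (var i) ≡ var (suc i)
  close-miss {j = j} refl j≢x rewrite <ᵇ-false (m≤m+n d j) | m+n∸m≡n d j | ≡ᵇ-false j≢x = refl

m+[n+o]≡n+m+o : ∀ m n o → m + (n + o) ≡ n + m + o
m+[n+o]≡n+m+o = solve-∀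

m+[n+o]≡n+[m+o] : ∀ m n o → m + (n + o) ≡ n + (m + o)
m+[n+o]≡n+[m+o] = solve-∀

m+[n+[o+p]]≡n+[m+o]+p : ∀ m n o p → m + (n + (o + p)) ≡ n + (m + o) + p
m+[n+[o+p]]≡n+[m+o]+p = solve-∀

m+n≤n+[m+o] : ∀ m n o → m + n ≤ n + (m + o)
m+n≤n+[m+o] m n o = subst (_≤ n + (m + o)) (+-comm n m) (+-monoʳ-≤ n (m≤m+n m o))

shiftFrom-shiftFrom : ∀ b c k U → shiftFrom (b + c) k (shiftFrom b c U) ≡ shiftFrom b (c + k) U
shiftFrom-shiftFrom b c k (var i) with cut b i
... | below i<b
  rewrite shiftFrom-below {b} {c} i<b | shiftFrom-below {b + c} {k} (<-≤-trans i<b (m≤m+n b c))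
        | shiftFrom-below {b} {c + k} i<b = refl
... | above j
  rewrite shiftFrom-above {b} {c} (m≤m+n b j) | shiftFrom-above {b + c} {k} {c + (b + j)} (m+n≤n+[m+o] b c j)
        | shiftFrom-above {b} {c + k} (m≤m+n b j) = cong var (m+[n+o]≡n+m+o k c (b + j))
shiftFrom-shiftFrom b c k (lam U) = cong lam (shiftFrom-shiftFrom (suc b) c k U)
shiftFrom-shiftFrom b c k (app U V) = cong₂ app (shiftFrom-shiftFrom b c k U) (shiftFrom-shiftFrom b c k V)

substN-shiftFrom : ∀ y c k U N → substN y (c + k) U (shiftFrom c k N) ≡ shiftFrom c k (substN y c U N)
substN-shiftFrom y c k U (var i) with cut c i
... | below i<c
  rewrite shiftFrom-below {c} {k} i<c | substN-below {y} {c + k} {U} (<-≤-trans i<c (m≤m+n c k))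
        | substN-below {y} {c} {U} i<c | shiftFrom-below {c} {k} i<c = refl
... | above j rewrite shiftFrom-above {c} {k} (m≤m+n c j) with j ≟ y
...   | yes refl
  rewrite substN-hit {j} {c + k} {U} (m+[n+o]≡n+m+o k c j) | substN-hit {j} {c} {U} refl = sym (shiftFrom-shiftFrom 0 c k U)
...   | no j≢y
  rewrite substN-miss {y} {c + k} {U} (m+[n+o]≡n+m+o k c j) j≢y | substN-miss {y} {c} {U} refl j≢y
        | shiftFrom-above {c} {k} (m≤m+n c j) = refl
substN-shiftFrom y c k U (lam N) = cong lam (substN-shiftFrom y (suc c) k U N)
substN-shiftFrom y c k U (app N N') = cong₂ app (substN-shiftFrom y c k U N) (substN-shiftFrom y c k U N')

substB-shiftFrom : ∀ c k N U → substB (c + k) N (shiftFrom c (suc k) U) ≡ shiftFrom c k U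
substB-shiftFrom c k N (var i) with cut c i
... | below i<c
  rewrite shiftFrom-below {c} {suc k} i<c | substB-below {c + k} {N} (<-≤-trans i<c (m≤m+n c k))
        | shiftFrom-below {c} {k} i<c = refl
... | above j
  rewrite shiftFrom-above {c} {suc k} (m≤m+n c j) | substB-above {c + k} {N} {suc (k + (c + j))} (s≤s (m+n≤n+[m+o] c k j))
        | shiftFrom-above {c} {k} (m≤m+n c j) = refl
substB-shiftFrom c k N (lam U) = cong lam (substB-shiftFrom (suc c) k N U)
substB-shiftFrom c k N (app U V) = cong₂ app (substB-shiftFrom c k N U) (substB-shiftFrom c k N V)

substN-substB : ∀ y k U N M → substN y k U (substB k N M) ≡ substB k (substN y 0 U N) (substN y (suc k) U M)
substN-substB y k U N (var i) with cut₃ k i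
... | below i<k
  rewrite substB-below {k} {N} i<k | substN-below {y} {k} {U} i<k | substN-below {y} {suc k} {U} (m<n⇒m<1+n i<k)
        | substB-below {k} {substN y 0 U N} i<k = refl
... | at rewrite substB-at {k} {N} | substN-below {y} {suc k} {U} (n<1+n k) | substB-at {k} {substN y 0 U N} =
  substN-shiftFrom y 0 k U N
... | above j rewrite substB-above {k} {N} {suc (k + j)} (s≤s (m≤m+n k j)) with j ≟ y
...   | yes refl rewrite substN-hit {j} {k} {U} refl | substN-hit {j} {suc k} {U} refl = sym (substB-shiftFrom 0 k (substN j 0 U N) U)
...   | no j≢y
  rewrite substN-miss {y} {k} {U} refl j≢y | substN-miss {y} {suc k} {U} {suc (k + j)} refl j≢y
        | substB-above {k} {substN y 0 U N} {suc (k + j)} (s≤s (m≤m+n k j)) = refl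
substN-substB y k U N (lam M) = cong lam (substN-substB y (suc k) U N M)
substN-substB y k U N (app M M') = cong₂ app (substN-substB y k U N M) (substN-substB y k U N M')

substB-close : ∀ x k N M → substB k N (close x k M) ≡ substN x k N M
substB-close x k N (var i) with cut k i
... | below i<k rewrite close-below {x} {k} i<k | substB-below {k} {N} i<k | substN-below {x} {k} {N} i<k = refl
... | above j with j ≟ x
...   | yes refl rewrite close-hit {j} {k} refl | substB-at {k} {N} | substN-hit {j} {k} {N} refl = refl
...   | no j≢x
  rewrite close-miss {x} {k} refl j≢x | substB-above {k} {N} {suc (k + j)} (s≤s (m≤m+n k j))
        | substN-miss {x} {k} {N} refl j≢x = refl
substB-close x k N (lam M) = cong lam (substB-close x (suc k) N M)
substB-close x k N (app M M') = cong₂ app (substB-close x k N M) (substB-close x k N M')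

close-shiftFrom : ∀ x c k d M → close x (c + (k + d)) (shiftFrom c k M) ≡ shiftFrom c k (close x (c + d) M)
close-shiftFrom x c k d (var i) with cut c i
... | below i<c
  rewrite shiftFrom-below {c} {k} i<c | close-below {x} {c + (k + d)} (<-≤-trans i<c (m≤m+n c (k + d)))
        | close-below {x} {c + d} (<-≤-trans i<c (m≤m+n c d)) | shiftFrom-below {c} {k} i<c = refl
... | above j rewrite shiftFrom-above {c} {k} (m≤m+n c j) with cut d j
...   | below j<d
  rewrite close-below {x} {c + (k + d)} {k + (c + j)}
            (subst (k + (c + j) <_) (m+[n+o]≡n+[m+o] k c d) (+-monoʳ-< k (+-monoʳ-< c j<d)))
        | close-below {x} {c + d} (+-monoʳ-< c j<d) | shiftFrom-above {c} {k} (m≤m+n c j) = refl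
...   | above l with l ≟ x
...     | yes refl
  rewrite close-hit {l} {c + (k + d)} {k + (c + (d + l))} (m+[n+[o+p]]≡n+[m+o]+p k c d l)
        | close-hit {l} {c + d} (sym (+-assoc c d l)) | shiftFrom-above {c} {k} (m≤m+n c d) = cong var (m+[n+o]≡n+[m+o] c k d)
...     | no l≢x
  rewrite close-miss {x} {c + (k + d)} {k + (c + (d + l))} (m+[n+[o+p]]≡n+[m+o]+p k c d l) l≢x
        | close-miss {x} {c + d} (sym (+-assoc c d l)) l≢x
        | shiftFrom-above {c} {k} {suc (c + (d + l))} (m≤n⇒m≤1+n (m≤m+n c (d + l))) = cong var (sym (+-suc k _))
close-shiftFrom x c k d (lam M) = cong lam (close-shiftFrom x (suc c) k d M)
close-shiftFrom x c k d (app M N) = cong₂ app (close-shiftFrom x c k d M) (close-shiftFrom x c k d N)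

close-substB : ∀ x k d a b → close x (k + d) (substB k b a) ≡ substB k (close x d b) (close x (suc (k + d)) a)
close-substB x k d (var i) b with cut₃ k i
... | below i<k
  rewrite substB-below {k} {b} i<k | close-below {x} {k + d} (<-≤-trans i<k (m≤m+n k d))
        | close-below {x} {suc (k + d)} (m<n⇒m<1+n (<-≤-trans i<k (m≤m+n k d))) | substB-below {k} {close x d b} i<k = refl
... | at rewrite substB-at {k} {b} | close-below {x} {suc (k + d)} (s≤s (m≤m+n k d)) | substB-at {k} {close x d b} =
  close-shiftFrom x 0 k d b
... | above j rewrite substB-above {k} {b} {suc (k + j)} (s≤s (m≤m+n k j)) with cut d j
...   | below j<d
  rewrite close-below {x} {k + d} (+-monoʳ-< k j<d) | close-below {x} {suc (k + d)} (s≤s (+-monoʳ-< k j<d))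
        | substB-above {k} {close x d b} {suc (k + j)} (s≤s (m≤m+n k j)) = refl
...   | above l with l ≟ x
...     | yes refl
  rewrite close-hit {l} {k + d} (sym (+-assoc k d l)) | close-hit {l} {suc (k + d)} (cong suc (sym (+-assoc k d l)))
        | substB-above {k} {close l d b} {suc (k + d)} (s≤s (m≤m+n k d)) = refl
...     | no l≢x
  rewrite close-miss {x} {k + d} (sym (+-assoc k d l)) l≢x | close-miss {x} {suc (k + d)} (cong suc (sym (+-assoc k d l))) l≢x
        | substB-above {k} {close x d b} {suc (suc (k + (d + l)))} (s≤s (m≤n⇒m≤1+n (m≤m+n k (d + l)))) = refl
close-substB x k d (lam a) b = cong lam (close-substB x (suc k) d a b)
close-substB x k d (app a a') b = cong₂ app (close-substB x k d a b) (close-substB x k d a' b)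

data FreeAt (x : Name) : ℕ → Tm → Set where
  var : ∀ {d i} → i ≡ d + x → FreeAt x d (var i)
  lam : ∀ {d M} → FreeAt x (suc d) M → FreeAt x d (lam M)
  appˡ : ∀ {d M N} → FreeAt x d M → FreeAt x d (app M N)
  appʳ : ∀ {d M N} → FreeAt x d N → FreeAt x d (app M N)

substN-fresh : ∀ {x d U} M → ¬ FreeAt x d M → substN x d U M ≡ M
substN-fresh {x} {d} {U} (var i) x∉M with cut d i
... | below i<d = substN-below {u = U} i<d
... | above j with j ≟ x
...   | yes refl = ⊥-elim (x∉M (var refl))
...   | no j≢x = substN-miss {u = U} refl j≢x
substN-fresh (lam M) x∉M = cong lam (substN-fresh M (λ p → x∉M (lam p)))
substN-fresh (app M N) x∉M = cong₂ app (substN-fresh M (λ p → x∉M (appˡ p))) (substN-fresh N (λ p → x∉M (appʳ p)))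

lookupIdx-∉ : ∀ {x} Γ → x ∉ Γ → lookupIdx Γ x ≡ length Γ + x
lookupIdx-∉ [] _ = refl
lookupIdx-∉ {x} (y ∷ Γ) x∉ rewrite ≡ᵇ-false {x} {y} (λ x≡y → x∉ (here x≡y)) =
  cong suc (lookupIdx-∉ Γ (λ p → x∉ (there p)))

lookupIdx-≥ : ∀ {x y} Γ → lookupIdx Γ y ≡ length Γ + x → y ≡ x × x ∉ Γ
lookupIdx-≥ [] eq = eq , λ ()
lookupIdx-≥ {x} {y} (z ∷ Γ) eq with y ≟ z
... | yes refl rewrite ≡ᵇ-refl y with eq
...   | ()
lookupIdx-≥ {x} {y} (z ∷ Γ) eq | no y≢z rewrite ≡ᵇ-false y≢z with lookupIdx-≥ Γ (suc-injective eq)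
... | refl , x∉Γ = refl , λ { (here refl) → y≢z refl ; (there p) → x∉Γ p }

FreeIn⇒FreeAt : ∀ {x} Γ t → FreeIn x t → x ∉ Γ → FreeAt x (length Γ) (conv Γ t)
FreeIn⇒FreeAt Γ (v y) fv-var x∉Γ = var (lookupIdx-∉ Γ x∉Γ)
FreeIn⇒FreeAt Γ (ƛ y t) (fv-lam x≢y p) x∉Γ =
  lam (FreeIn⇒FreeAt (y ∷ Γ) t p λ { (here x≡y) → x≢y x≡y ; (there q) → x∉Γ q })
FreeIn⇒FreeAt Γ (t · u) (fv-appl p) x∉Γ = appˡ (FreeIn⇒FreeAt Γ t p x∉Γ)
FreeIn⇒FreeAt Γ (t · u) (fv-appr p) x∉Γ = appʳ (FreeIn⇒FreeAt Γ u p x∉Γ)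

FreeAt⇒FreeIn : ∀ {x} Γ t → FreeAt x (length Γ) (conv Γ t) → FreeIn x t × x ∉ Γ
FreeAt⇒FreeIn Γ (v y) (var eq) with lookupIdx-≥ Γ eq
... | refl , x∉Γ = fv-var , x∉Γ
FreeAt⇒FreeIn Γ (ƛ y t) (lam p) with FreeAt⇒FreeIn (y ∷ Γ) t p
... | q , x∉y∷Γ = fv-lam (λ x≡y → x∉y∷Γ (here x≡y)) q , λ r → x∉y∷Γ (there r)
FreeAt⇒FreeIn Γ (t · u) (appˡ p) with FreeAt⇒FreeIn Γ t p
... | q , x∉Γ = fv-appl q , x∉Γ
FreeAt⇒FreeIn Γ (t · u) (appʳ p) with FreeAt⇒FreeIn Γ u p
... | q , x∉Γ = fv-appr q , x∉Γ

FreeIn⇔FreeAt : ∀ {x} t → FreeIn x t ⇔ FreeAt x 0 ⟦ t ⟧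
FreeIn⇔FreeAt t = mk⇔ (λ p → FreeIn⇒FreeAt [] t p (λ ())) (λ p → proj₁ (FreeAt⇒FreeIn [] t p))

FreeIn-resp-α : ∀ {x t u} → ⟦ t ⟧ ≡ ⟦ u ⟧ → FreeIn x t → FreeIn x u
FreeIn-resp-α {t = t} {u} t≈u p =
  Equivalence.from (FreeIn⇔FreeAt u) (subst (FreeAt _ 0) t≈u (Equivalence.to (FreeIn⇔FreeAt t) p))

FreeIn⇒∈names : ∀ {x} t → FreeIn x t → x ∈ names t
FreeIn⇒∈names (v y) fv-var = here refl
FreeIn⇒∈names (ƛ y t) (fv-lam _ p) = there (FreeIn⇒∈names t p)
FreeIn⇒∈names (t · u) (fv-appl p) = ∈-++⁺ˡ (FreeIn⇒∈names t p)
FreeIn⇒∈names (t · u) (fv-appr p) = ∈-++⁺ʳ (names t) (FreeIn⇒∈names u p)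

bv⊆names : ∀ {x} t → x ∈ bv t → x ∈ names t
bv⊆names (ƛ y t) (here x≡y) = here x≡y
bv⊆names (ƛ y t) (there p) = there (bv⊆names t p)
bv⊆names (t · u) p with ∈-++⁻ (bv t) p
... | inj₁ q = ∈-++⁺ˡ (bv⊆names t q)
... | inj₂ q = ∈-++⁺ʳ (names t) (bv⊆names u q)

-- Only applied to closed variables, which are variables.
incVar : Tm → Tm
incVar (var i) = var (suc i)
incVar M = M

close-var-suc : ∀ x d j → close x (suc d) (var (suc j)) ≡ incVar (close x d (var j))
close-var-suc x d j with j <ᵇ d
... | true = refl
... | false with j ∸ d ≡ᵇ x
...   | true = refl
...   | false = refl

lookupIdx-snoc : ∀ Γ x y → var (lookupIdx (Γ ++ x ∷ []) y) ≡ close x (length Γ) (var (lookupIdx Γ y))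
lookupIdx-snoc [] x y with y ≡ᵇ x
... | true = refl
... | false = refl
lookupIdx-snoc (z ∷ Γ) x y with y ≡ᵇ z
... | true = refl
... | false = trans (cong incVar (lookupIdx-snoc Γ x y)) (sym (close-var-suc x (length Γ) (lookupIdx Γ y)))

conv-snoc : ∀ Γ x t → conv (Γ ++ x ∷ []) t ≡ close x (length Γ) (conv Γ t)
conv-snoc Γ x (v y) = lookupIdx-snoc Γ x y
conv-snoc Γ x (ƛ y t) = cong lam (conv-snoc (y ∷ Γ) x t)
conv-snoc Γ x (t · u) = cong₂ app (conv-snoc Γ x t) (conv-snoc Γ x u)

⟦ƛ⟧ : ∀ x t → ⟦ ƛ x t ⟧ ≡ lam (close x 0 ⟦ t ⟧)
⟦ƛ⟧ x t = cong lam (conv-snoc [] x t)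

downTmUnder : ℕ → Tm → Env → Tm
downTmUnder d M [] = M
downTmUnder d M ((y , e) ∷ E) = downTmUnder d (substN y d ⟦ e ⟧ M) E

downTm≡downTmUnder0 : ∀ M E → downTm M E ≡ downTmUnder 0 M E
downTm≡downTmUnder0 M [] = refl
downTm≡downTmUnder0 M ((y , e) ∷ E) = downTm≡downTmUnder0 (substN y 0 ⟦ e ⟧ M) E

downTmUnder-lam : ∀ d M E → downTmUnder d (lam M) E ≡ lam (downTmUnder (suc d) M E)
downTmUnder-lam d M [] = refl
downTmUnder-lam d M ((y , e) ∷ E) = downTmUnder-lam d (substN y (suc d) ⟦ e ⟧ M) E

downTmUnder-substB : ∀ k N M E → downTmUnder k (substB k N M) E ≡ substB k (downTmUnder 0 N E) (downTmUnder (suc k) M E)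
downTmUnder-substB k N M [] = refl
downTmUnder-substB k N M ((y , e) ∷ E) =
  trans (cong (λ Z → downTmUnder k Z E) (substN-substB y k ⟦ e ⟧ N M))
        (downTmUnder-substB k (substN y 0 ⟦ e ⟧ N) (substN y (suc k) ⟦ e ⟧ M) E)

downTm-lam : ∀ x t E → downTm ⟦ ƛ x t ⟧ E ≡ lam (downTmUnder 1 (close x 0 ⟦ t ⟧) E)
downTm-lam x t E = begin
  downTm ⟦ ƛ x t ⟧ E                       ≡⟨ downTm≡downTmUnder0 ⟦ ƛ x t ⟧ E ⟩
  downTmUnder 0 ⟦ ƛ x t ⟧ E                ≡⟨ cong (λ M → downTmUnder 0 M E) (⟦ƛ⟧ x t) ⟩
  downTmUnder 0 (lam (close x 0 ⟦ t ⟧)) E  ≡⟨ downTmUnder-lam 0 (close x 0 ⟦ t ⟧) E ⟩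
  lam (downTmUnder 1 (close x 0 ⟦ t ⟧) E)  ∎
  where open ≡-Reasoning

downTm-β : ∀ x M U E → downTm (M [ x ≔ U ]) E ≡ substB 0 (downTm U E) (downTmUnder 1 (close x 0 M) E)
downTm-β x M U E = begin
  downTm (substN x 0 U M) E                   ≡⟨ cong (λ N → downTm N E) (sym (substB-close x 0 U M)) ⟩
  downTm (substB 0 U (close x 0 M)) E         ≡⟨ downTm≡downTmUnder0 _ E ⟩
  downTmUnder 0 (substB 0 U (close x 0 M)) E  ≡⟨ downTmUnder-substB 0 U (close x 0 M) E ⟩
  substB 0 (downTmUnder 0 U E) body           ≡⟨ cong (λ N → substB 0 N body) (sym (downTm≡downTmUnder0 U E)) ⟩
  substB 0 (downTm U E) body                  ∎
  where
  open ≡-Reasoning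
  body = downTmUnder 1 (close x 0 M) E

downTm-fresh : ∀ {x} c u E → ¬ FreeIn x c → downTm ⟦ c ⟧ ((x , u) ∷ E) ≡ downTm ⟦ c ⟧ E
downTm-fresh c u E x∉c = cong (λ M → downTm M E) (substN-fresh ⟦ c ⟧ (λ p → x∉c (Equivalence.from (FreeIn⇔FreeAt c) p)))

downTms-fresh : ∀ {x} S u E → (∀ {c} → c ∈ S → ¬ FreeIn x c) →
  map (λ w → downTm ⟦ w ⟧ ((x , u) ∷ E)) S ≡ map (λ w → downTm ⟦ w ⟧ E) S
downTms-fresh S u E x∉S = map-cong-local (All.tabulate λ {c} c∈ → downTm-fresh c u E (x∉S c∈))


-- External reduction

app-injective : ∀ {M N M' N' : Tm} → app M N ≡ app M' N' → M ≡ M' × N ≡ N'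
app-injective refl = refl , refl

lam-injective : ∀ {M M' : Tm} → lam M ≡ lam M' → M ≡ M'
lam-injective refl = refl

plugR-app : ∀ S {M N} → ∃ λ P → ∃ λ Q → plugR S (app M N) ≡ app P Q
plugR-app hole = _ , _ , refl
plugR-app (rigB r _ B) = _ , _ , refl
plugR-app (rApp S t) = _ , _ , refl

plugR-app≢lam : ∀ S {M N A} → plugR S (app M N) ≢ lam A
plugR-app≢lam S eq with plugR-app S
... | _ , _ , eq' with trans (sym eq') eq
... | ()

plugE-app≢var : ∀ C {M N i} → plugE C (app M N) ≢ var i
plugE-app≢var (eLam C) ()
plugE-app≢var (eR S) eq with plugR-app S
... | _ , _ , eq' with trans (sym eq') eq
... | ()

var-irreducible : ∀ {i u} → ¬ (var i →ext u)
var-irreducible step = go step refl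
  where
  go : ∀ {i T u} → T →ext u → var i ≡ T → ⊥
  go (ext C (root a b)) eq = plugE-app≢var C (sym eq)

infix 4 _→ₕ_

data _→ₕ_ : Tm → Tm → Set where
  β-head : ∀ A N → app (lam A) N →ₕ substB 0 N A
  app-head : ∀ {T T'} a → T →ₕ T' → app T a →ₕ app T' a

→ₕ-not-rigid : ∀ {T T'} → T →ₕ T' → ¬ Rigid T
→ₕ-not-rigid (β-head A N) (rapp () _)
→ₕ-not-rigid (app-head a h) (rapp r _) = →ₕ-not-rigid h r

plugStack-→ₕ : ∀ {H H'} args → H →ₕ H' → plugStack H args →ₕ plugStack H' args
plugStack-→ₕ [] h = h
plugStack-→ₕ (a ∷ args) h = plugStack-→ₕ args (app-head a h)

-- A head-reduction spine is not rigid, so no rigid context r B reaches into it.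
→ext-head : ∀ {T T' U} → T →ₕ T' → T →ext U → U ≡ T'
→ext-head h (ext C (root a b)) = go h C refl
  where
  go : ∀ {T T'} → T →ₕ T' → ∀ C → T ≡ plugE C (app (lam a) b) → plugE C (substB 0 b a) ≡ T'
  go (β-head A N) (eLam C) ()
  go (app-head _ _) (eLam C) ()
  go (β-head A N) (eR hole) refl = refl
  go (app-head _ ()) (eR hole) refl
  go (β-head A N) (eR (rigB r () B)) refl
  go (app-head _ h) (eR (rigB r ρ B)) refl = ⊥-elim (→ₕ-not-rigid h ρ)
  go (β-head A N) (eR (rApp S t)) eq = ⊥-elim (plugR-app≢lam S (sym (proj₁ (app-injective eq))))
  go (app-head _ h) (eR (rApp S t)) eq with app-injective eq
  ... | eq' , refl = cong (λ M → app M t) (go h (eR S) eq')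

→ext-lam⁻ : ∀ {X u} → lam X →ext u → ∃ λ u' → (X →ext u') × u ≡ lam u'
→ext-lam⁻ step = go step refl
  where
  go : ∀ {X T u} → T →ext u → lam X ≡ T → ∃ λ u' → (X →ext u') × u ≡ lam u'
  go (ext (eLam C) r) refl = _ , ext C r , refl
  go (ext (eR S) (root a b)) eq = ⊥-elim (plugR-app≢lam S (sym eq))

→ext-rigid-app⁻ : ∀ {M N u} → Rigid M → app M N →ext u →
  (∃ λ M' → (M →ext M') × u ≡ app M' N) ⊎ (∃ λ N' → (N →ext N') × u ≡ app M N')
→ext-rigid-app⁻ ρ step = go ρ step refl
  where
  go : ∀ {M N T u} → Rigid M → T →ext u → app M N ≡ T →
    (∃ λ M' → (M →ext M') × u ≡ app M' N) ⊎ (∃ λ N' → (N →ext N') × u ≡ app M N')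
  go ρ (ext (eLam C) r) ()
  go () (ext (eR hole) (root a b)) refl
  go ρ (ext (eR (rigB r _ B)) step) refl = inj₂ (_ , ext B step , refl)
  go ρ (ext (eR (rApp S t)) step) refl = inj₁ (_ , ext (eR S) step , refl)

close-var : ∀ x d i → ∃ λ j → close x d (var i) ≡ var j
close-var x d i with i <ᵇ d
... | true = i , refl
... | false with i ∸ d ≡ᵇ x
...   | true = d , refl
...   | false = suc i , refl

close-var≢app : ∀ {x d i M N} → close x d (var i) ≢ app M N
close-var≢app {x} {d} {i} eq with close-var x d i
... | _ , eq' with trans (sym eq') eq
... | ()

close-var≢lam : ∀ {x d i M} → close x d (var i) ≢ lam M
close-var≢lam {x} {d} {i} eq with close-var x d i
... | _ , eq' with trans (sym eq') eq
... | ()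

Rigid-close⁻ : ∀ {x d} M → Rigid (close x d M) → Rigid M
Rigid-close⁻ (var i) _ = rvar i
Rigid-close⁻ (app M N) (rapp ρ _) = rapp (Rigid-close⁻ M ρ) N

-- close maps variables to variables, so each redex of close x d M, with its external context,
-- is the image of a redex of M.
mutual
  close-redexE⁻ : ∀ C x d M a b → close x d M ≡ plugE C (app (lam a) b) →
    ∃ λ C' → ∃ λ a' → ∃ λ b' →
      M ≡ plugE C' (app (lam a') b') × close x d (plugE C' (substB 0 b' a')) ≡ plugE C (substB 0 b a)
  close-redexE⁻ (eLam C) x d (var i) a b eq = ⊥-elim (close-var≢lam {x} {d} {i} eq)
  close-redexE⁻ (eLam C) x d (lam M) a b eq with close-redexE⁻ C x (suc d) M a b (lam-injective eq)
  ... | C' , a' , b' , refl , eq' = eLam C' , a' , b' , refl , cong lam eq'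
  close-redexE⁻ (eLam C) x d (app M N) a b ()
  close-redexE⁻ (eR S) x d M a b eq with close-redexR⁻ S x d M a b eq
  ... | S' , a' , b' , eq₁ , eq₂ = eR S' , a' , b' , eq₁ , eq₂

  close-redexR⁻ : ∀ S x d M a b → close x d M ≡ plugR S (app (lam a) b) →
    ∃ λ S' → ∃ λ a' → ∃ λ b' →
      M ≡ plugR S' (app (lam a') b') × close x d (plugR S' (substB 0 b' a')) ≡ plugR S (substB 0 b a)
  close-redexR⁻ S x d (var i) a b eq with plugR-app S {lam a} {b}
  ... | _ , _ , eq' = ⊥-elim (close-var≢app {x} {d} {i} (trans eq eq'))
  close-redexR⁻ S x d (lam M) a b eq with plugR-app S {lam a} {b}
  ... | _ , _ , eq' with trans eq eq'
  ... | ()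
  close-redexR⁻ hole x d (app (var i) N) a b eq = ⊥-elim (close-var≢lam {x} {d} {i} (proj₁ (app-injective eq)))
  close-redexR⁻ hole x d (app (app M M') N) a b ()
  close-redexR⁻ hole x d (app (lam M) N) a b refl = hole , M , N , refl , close-substB x 0 d M N
  close-redexR⁻ (rigB r ρ B) x d (app M N) a b eq with app-injective eq
  ... | refl , eq₂ with close-redexE⁻ B x d N a b eq₂
  ... | B' , a' , b' , refl , eq₃ = rigB M (Rigid-close⁻ M ρ) B' , a' , b' , refl , cong (app (close x d M)) eq₃
  close-redexR⁻ (rApp S t) x d (app M N) a b eq with app-injective eq
  ... | eq₁ , refl with close-redexR⁻ S x d M a b eq₁
  ... | S' , a' , b' , refl , eq₃ = rApp S' N , a' , b' , refl , cong (λ P → app P (close x d N)) eq₃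

→ext-close⁻ : ∀ {x d M u} → close x d M →ext u → ∃ λ M' → (M →ext M') × close x d M' ≡ u
→ext-close⁻ step = go step refl
  where
  go : ∀ {x d M T u} → T →ext u → close x d M ≡ T → ∃ λ M' → (M →ext M') × close x d M' ≡ u
  go {x} {d} {M} (ext C (root a b)) eq with close-redexE⁻ C x d M a b eq
  ... | C' , a' , b' , refl , eq' = plugE C' (substB 0 b' a') , ext C' (root a' b') , eq'

-- Approximants

mutual
  data Approx : MC → Set where
    hole : ∀ α → Approx (mhole α)
    lam : ∀ x {C} → Approx C → Approx (mlam x C)
    rigid : ∀ {C} → RigidApprox C → Approx C

  data RigidApprox : MC → Set where
    var : ∀ x → RigidApprox (mv x)
    app : ∀ {C D} → RigidApprox C → Approx D → RigidApprox (mapp C D)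

Filling : Set
Filling = JName → Maybe Tm

fill-app⁻ : ∀ f C D {t} → fill f (mapp C D) ≡ just t →
  ∃ λ M → ∃ λ N → fill f C ≡ just M × fill f D ≡ just N × t ≡ app M N
fill-app⁻ f C D eq with fill f C | fill f D
fill-app⁻ f C D refl | just M | just N = M , N , refl , refl , refl

fill-app⁺ : ∀ f C D {M N} → fill f C ≡ just M → fill f D ≡ just N → fill f (mapp C D) ≡ just (app M N)
fill-app⁺ f C D eqC eqD rewrite eqC | eqD = refl

fill-lam⁻ : ∀ f x C {t} → fill f (mlam x C) ≡ just t → ∃ λ M → fill f C ≡ just M × t ≡ lam (close x 0 M)
fill-lam⁻ f x C eq with fill f C
fill-lam⁻ f x C refl | just M = M , refl , refl

fill-lam⁺ : ∀ f x C {M} → fill f C ≡ just M → fill f (mlam x C) ≡ just (lam (close x 0 M))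
fill-lam⁺ f x C eq rewrite eq = refl

fill-cong : ∀ {f g} B → (∀ {α} → α ∈ mcHoles B → f α ≡ g α) → fill f B ≡ fill g B
fill-cong (mv x) f≗g = refl
fill-cong (mhole α) f≗g = f≗g (here refl)
fill-cong {f} {g} (mlam x C) f≗g rewrite fill-cong {f} {g} C f≗g = refl
fill-cong {f} {g} (mapp C D) f≗g
  rewrite fill-cong {f} {g} C (λ p → f≗g (∈-++⁺ˡ p)) | fill-cong {f} {g} D (λ p → f≗g (∈-++⁺ʳ (mcHoles C) p)) = refl

fill-rigid : ∀ f {C M} → RigidApprox C → fill f C ≡ just M → Rigid M
fill-rigid f (var x) refl = rvar x
fill-rigid f (app {C} {D} ρ _) eq with fill-app⁻ f C D eq
... | M , N , eqC , _ , refl = rapp (fill-rigid f ρ eqC) N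

update : Filling → JName → Tm → Filling
update f α T β = if β ≡ᵇ α then just T else f β

update-≡ : ∀ f α T → update f α T α ≡ just T
update-≡ f α T rewrite ≡ᵇ-refl α = refl

update-≢ : ∀ f α T {β} → β ≢ α → update f α T β ≡ f β
update-≢ f α T β≢α rewrite ≡ᵇ-false β≢α = refl

fill-update-∉ : ∀ f α T C → α ∉ mcHoles C → fill (update f α T) C ≡ fill f C
fill-update-∉ f α T C α∉C = fill-cong C λ {β} β∈C → update-≢ f α T λ { refl → α∉C β∈C }

record HoleStep (B : MC) (f : Filling) (u : Tm) : Set where
  constructor hole-step
  field
    α : JName
    α∈B : α ∈ mcHoles B
    {M M'} : Tm
    filled-α : f α ≡ just M
    step : M →ext M'
    refilled : fill (update f α M') B ≡ just u

mutual
  approx-step : ∀ {B} → Approx B → Unique (mcHoles B) → ∀ f {t u} → fill f B ≡ just t → t →ext u → HoleStep B f u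
  approx-step (hole α) _ f eq step = hole-step α (here refl) eq step (update-≡ f α _)
  approx-step (lam x {C} A) uniq f eq step with fill-lam⁻ f x C eq
  ... | M , eqC , refl with →ext-lam⁻ step
  ... | _ , step' , refl with →ext-close⁻ {x} {0} {M} step'
  ... | M' , stepM , refl with approx-step A uniq f eqC stepM
  ... | hole-step α α∈ fα stepα refilled = hole-step α α∈ fα stepα (fill-lam⁺ _ x C refilled)
  approx-step (rigid ρ) uniq f eq step = rigid-step ρ uniq f eq step

  rigid-step : ∀ {B} → RigidApprox B → Unique (mcHoles B) → ∀ f {t u} → fill f B ≡ just t → t →ext u → HoleStep B f u
  rigid-step (var x) _ f refl step = ⊥-elim (var-irreducible step)
  rigid-step (app {C} {D} ρ A) uniq f eq step with fill-app⁻ f C D eq | Unique-++⁻ (mcHoles C) uniq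
  ... | M , N , eqC , eqD , refl | uC , uD , C#D with →ext-rigid-app⁻ (fill-rigid f ρ eqC) step
  ... | inj₁ (M' , stepM , refl) with rigid-step ρ uC f eqC stepM
  ...   | hole-step α α∈ fα stepα refilled =
    hole-step α (∈-++⁺ˡ α∈) fα stepα
      (fill-app⁺ _ C D refilled (trans (fill-update-∉ f α _ D (λ α∈D → C#D (α∈ , α∈D))) eqD))
  rigid-step (app {C} {D} ρ A) uniq f eq step | M , N , eqC , eqD , refl | uC , uD , C#D | inj₂ (N' , stepN , refl)
    with approx-step A uD f eqD stepN
  ...   | hole-step α α∈ fα stepα refilled =
    hole-step α (∈-++⁺ʳ (mcHoles C) α∈) fα stepα
      (fill-app⁺ _ C D (trans (fill-update-∉ f α _ C (λ α∈C → C#D (α∈C , α∈))) eqC) refilled)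

mutual
  Approx-replace : ∀ {C} α → Approx C → ∀ {B} → Approx B → Approx (B ⟪ α ← C ⟫)
  Approx-replace α A (hole β) with β ≡ᵇ α
  ... | true = A
  ... | false = hole β
  Approx-replace α A (lam x A') = lam x (Approx-replace α A A')
  Approx-replace α A (rigid ρ) = rigid (RigidApprox-replace α A ρ)

  RigidApprox-replace : ∀ {C} α → Approx C → ∀ {B} → RigidApprox B → RigidApprox (B ⟪ α ← C ⟫)
  RigidApprox-replace α A (var x) = var x
  RigidApprox-replace α A (app ρ A') = app (RigidApprox-replace α A ρ) (Approx-replace α A A')

∈-holes-replace⁻ : ∀ {β α C} B → β ∈ mcHoles (B ⟪ α ← C ⟫) →
  (β ∈ mcHoles B × β ≢ α) ⊎ (β ∈ mcHoles C × α ∈ mcHoles B)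
∈-holes-replace⁻ {β} {α} (mhole γ) p with γ ≟ α
... | yes refl rewrite ≡ᵇ-refl γ = inj₂ (p , here refl)
∈-holes-replace⁻ {β} {α} (mhole γ) p | no γ≢α rewrite ≡ᵇ-false γ≢α with p
... | here refl = inj₁ (here refl , γ≢α)
∈-holes-replace⁻ (mlam x B) p = ∈-holes-replace⁻ B p
∈-holes-replace⁻ {α = α} {C} (mapp B D) p with ∈-++⁻ (mcHoles (B ⟪ α ← C ⟫)) p
... | inj₁ q with ∈-holes-replace⁻ B q
...   | inj₁ (r , β≢α) = inj₁ (∈-++⁺ˡ r , β≢α)
...   | inj₂ (r , α∈B) = inj₂ (r , ∈-++⁺ˡ α∈B)
∈-holes-replace⁻ {α = α} {C} (mapp B D) p | inj₂ q with ∈-holes-replace⁻ D q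
...   | inj₁ (r , β≢α) = inj₁ (∈-++⁺ʳ (mcHoles B) r , β≢α)
...   | inj₂ (r , α∈D) = inj₂ (r , ∈-++⁺ʳ (mcHoles B) α∈D)

Unique-holes-replace : ∀ {α C} B → Unique (mcHoles B) → Unique (mcHoles C) →
  (∀ {β} → β ∈ mcHoles C → β ∈ mcHoles B → β ≡ α) → Unique (mcHoles (B ⟪ α ← C ⟫))
Unique-holes-replace (mv x) _ _ _ = []
Unique-holes-replace {α} (mhole β) uB uC _ with β ≟ α
... | yes refl rewrite ≡ᵇ-refl β = uC
... | no β≢α rewrite ≡ᵇ-false β≢α = uB
Unique-holes-replace (mlam x B) uB uC C∩B⊆α = Unique-holes-replace B uB uC C∩B⊆α
Unique-holes-replace {α} {C} (mapp B D) uBD uC C∩BD⊆α with Unique-++⁻ (mcHoles B) uBD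
... | uB , uD , B#D = Unique.++⁺
  (Unique-holes-replace B uB uC (λ p q → C∩BD⊆α p (∈-++⁺ˡ q)))
  (Unique-holes-replace D uD uC (λ p q → C∩BD⊆α p (∈-++⁺ʳ (mcHoles B) q)))
  disjoint
  where
  disjoint : Disjoint (mcHoles (B ⟪ α ← C ⟫)) (mcHoles (D ⟪ α ← C ⟫))
  disjoint (p , q) with ∈-holes-replace⁻ B p | ∈-holes-replace⁻ D q
  ... | inj₁ (β∈B , _) | inj₁ (β∈D , _) = B#D (β∈B , β∈D)
  ... | inj₁ (β∈B , β≢α) | inj₂ (β∈C , _) = β≢α (C∩BD⊆α β∈C (∈-++⁺ˡ β∈B))
  ... | inj₂ (β∈C , _) | inj₁ (β∈D , β≢α) = β≢α (C∩BD⊆α β∈C (∈-++⁺ʳ (mcHoles B) β∈D))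
  ... | inj₂ (_ , α∈B) | inj₂ (_ , α∈D) = B#D (α∈B , α∈D)

holes-foldl-app : ∀ C βs → mcHoles (foldl (λ C' β → mapp C' (mhole β)) C βs) ≡ mcHoles C ++ βs
holes-foldl-app C [] = sym (++-identityʳ (mcHoles C))
holes-foldl-app C (β ∷ βs) = trans (holes-foldl-app (mapp C (mhole β)) βs) (++-assoc (mcHoles C) (β ∷ []) βs)

holes-varCtx : ∀ x βs → mcHoles (varCtx x βs) ≡ βs
holes-varCtx x βs = holes-foldl-app (mv x) βs

RigidApprox-foldl-app : ∀ {C} βs → RigidApprox C → RigidApprox (foldl (λ C' β → mapp C' (mhole β)) C βs)
RigidApprox-foldl-app [] ρ = ρ
RigidApprox-foldl-app (β ∷ βs) ρ = RigidApprox-foldl-app βs (app ρ (hole β))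

RigidApprox-varCtx : ∀ x βs → RigidApprox (varCtx x βs)
RigidApprox-varCtx x βs = RigidApprox-foldl-app βs (var x)

-- The invariant of reachable states

boundNames : List PTm → List Name
boundNames = concatMap bv

∈-boundNames⁻ : ∀ {y} cs → y ∈ boundNames cs → ∃ λ c → c ∈ cs × y ∈ bv c
∈-boundNames⁻ cs p = find (∈-concatMap⁻ bv {xs = cs} p)

-- Binders inside environment entries need no control: sub only copies fresh renamings of them.
record WellBound (cs es : List PTm) : Set where
  constructor mkWellBound
  field
    unique : Unique (boundNames cs)
    not-free : ∀ {x c} → x ∈ boundNames cs → c ∈ cs ++ es → ¬ FreeIn x c

WellBound-resp-↭ : ∀ {cs cs' es} → cs ↭ cs' → WellBound cs es → WellBound cs' es
WellBound-resp-↭ {es = es} p (mkWellBound u nf) = mkWellBound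
  (Unique-resp-↭ (concatMap-↭ bv p) u)
  (λ x∈ c∈ → nf (∈-resp-↭ (concatMap-↭ bv (↭-sym p)) x∈) (∈-resp-↭ (++⁺ʳ es (↭-sym p)) c∈))

WellBound-app : ∀ {t u L es} → WellBound (t · u ∷ L) es → WellBound (t ∷ u ∷ L) es
WellBound-app {t} {u} {L} (mkWellBound uniq nf) = mkWellBound (subst Unique assoc uniq) not-free
  where
  assoc : (bv t ++ bv u) ++ boundNames L ≡ bv t ++ bv u ++ boundNames L
  assoc = ++-assoc (bv t) (bv u) (boundNames L)
  not-free : ∀ {x c} → x ∈ bv t ++ bv u ++ boundNames L → c ∈ t ∷ u ∷ L ++ _ → ¬ FreeIn x c
  not-free x∈ (here refl) p = nf (subst (_ ∈_) (sym assoc) x∈) (here refl) (fv-appl p)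
  not-free x∈ (there (here refl)) p = nf (subst (_ ∈_) (sym assoc) x∈) (here refl) (fv-appr p)
  not-free x∈ (there (there c∈)) = nf (subst (_ ∈_) (sym assoc) x∈) (there c∈)

WellBound-unbind : ∀ {x t} D {L es es'} → WellBound (ƛ x t ∷ D ++ L) es → (∀ {c} → c ∈ es' → c ∈ D ++ es) →
  WellBound (t ∷ L) es'
WellBound-unbind {x} {t} D {L} {es} (mkWellBound uniq nf) es'⊆ = mkWellBound (Unique-drop-middle (bv t) (boundNames D) uniq') not-free
  where
  split : boundNames (D ++ L) ≡ boundNames D ++ boundNames L
  split = concatMap-++ bv D L
  uniq' : Unique (bv t ++ boundNames D ++ boundNames L)
  uniq' = subst (λ bs → Unique (bv t ++ bs)) split (Unique.drop⁺ 1 uniq)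
  old : ∀ {y} → y ∈ bv t ++ boundNames L → y ∈ bv t ++ boundNames (D ++ L)
  old p = subst (λ bs → _ ∈ bv t ++ bs) (sym split) (∈-insert-middle (bv t) (boundNames D) p)
  x∉ : x ∉ bv t ++ boundNames L
  x∉ p = Unique.Unique[x∷xs]⇒x∉xs uniq (old p)
  not-free : ∀ {y c} → y ∈ bv t ++ boundNames L → c ∈ t ∷ L ++ _ → ¬ FreeIn y c
  not-free y∈ (here refl) p = nf (there (old y∈)) (here refl) (fv-lam (λ { refl → x∉ y∈ }) p)
  not-free y∈ (there c∈) with ∈-++⁻ L c∈
  ... | inj₁ c∈L = nf (there (old y∈)) (there (∈-++⁺ˡ (∈-++⁺ʳ D c∈L)))
  ... | inj₂ c∈es' with ∈-++⁻ D (es'⊆ c∈es')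
  ...   | inj₁ c∈D = nf (there (old y∈)) (there (∈-++⁺ˡ (∈-++⁺ˡ c∈D)))
  ...   | inj₂ c∈es = nf (there (old y∈)) (there (∈-++⁺ʳ (D ++ L) c∈es))

WellBound-drop-var : ∀ {x L es} → WellBound (v x ∷ L) es → WellBound L es
WellBound-drop-var (mkWellBound uniq nf) = mkWellBound uniq (λ x∈ c∈ → nf x∈ (there c∈))

WellBound-rename : ∀ {x t' t₀ L es} → WellBound (v x ∷ L) es → t₀ ∈ es → ⟦ t' ⟧ ≡ ⟦ t₀ ⟧ → Unique (bv t') →
  (∀ {y c} → y ∈ bv t' → c ∈ L ++ es → y ∉ names c) → WellBound (t' ∷ L) es
WellBound-rename {t' = t'} {t₀} {L} {es} (mkWellBound uniq nf) t₀∈ t'≈t₀ uniq' fresh =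
  mkWellBound (Unique.++⁺ uniq' uniq disjoint) not-free
  where
  disjoint : Disjoint (bv t') (boundNames L)
  disjoint (y∈t' , y∈L) with ∈-boundNames⁻ L y∈L
  ... | c , c∈L , y∈c = fresh y∈t' (∈-++⁺ˡ c∈L) (bv⊆names c y∈c)
  witness : ∀ {y c} → c ∈ t' ∷ L ++ es → FreeIn y c → ∃ λ c₀ → c₀ ∈ L ++ es × FreeIn y c₀
  witness (here refl) p = t₀ , ∈-++⁺ʳ L t₀∈ , FreeIn-resp-α t'≈t₀ p
  witness (there c∈) p = _ , c∈ , p
  not-free : ∀ {y c} → y ∈ bv t' ++ boundNames L → c ∈ t' ∷ L ++ es → ¬ FreeIn y c
  not-free y∈ c∈ p with witness c∈ p | ∈-++⁻ (bv t') y∈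
  ... | c₀ , c₀∈ , p₀ | inj₁ y∈t' = fresh y∈t' c₀∈ (FreeIn⇒∈names c₀ p₀)
  ... | c₀ , c₀∈ , p₀ | inj₂ y∈L = nf y∈L (there c₀∈) p₀

jobTerms : Job → List PTm
jobTerms (job t S _) = t ∷ S

components : List Job → List PTm
components = concatMap jobTerms

envTerms : Env → List PTm
envTerms = map proj₂

components-focus : ∀ P₁ j P₂ → components (P₁ ++ j ∷ P₂) ↭ jobTerms j ++ components (P₁ ++ P₂)
components-focus P₁ j P₂ = concatMap-↭ jobTerms (shift j P₁ P₂)

lookupEnv-∈ : ∀ E {x t} → lookupEnv E x ≡ just t → t ∈ envTerms E
lookupEnv-∈ ((y , u) ∷ E) {x} eq with x ≡ᵇ y
lookupEnv-∈ ((y , u) ∷ E) refl | true = here refl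
lookupEnv-∈ ((y , u) ∷ E) eq | false = there (lookupEnv-∈ E eq)

∈-concatL-names : ∀ {y c} S → c ∈ S → y ∈ names c → y ∈ concatL (map names S)
∈-concatL-names (c ∷ S) (here refl) p = ∈-++⁺ˡ p
∈-concatL-names (c ∷ S) (there c∈) p = ∈-++⁺ʳ (names c) (∈-concatL-names S c∈ p)

∈-jobNames : ∀ {y c} P → c ∈ components P → y ∈ names c → y ∈ concatL (map jobNamesOcc P)
∈-jobNames (job t S α ∷ P) (here refl) p = ∈-++⁺ˡ (∈-++⁺ˡ p)
∈-jobNames (job t S α ∷ P) (there c∈) p with ∈-++⁻ S c∈
... | inj₁ c∈S = ∈-++⁺ˡ (∈-++⁺ʳ (names t) (∈-concatL-names S c∈S p))
... | inj₂ c∈P = ∈-++⁺ʳ (jobNamesOcc (job t S α)) (∈-jobNames P c∈P p)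

∈-envNames : ∀ {y c} E → c ∈ envTerms E → y ∈ names c → y ∈ envNames E
∈-envNames ((x , t) ∷ E) (here refl) p = there (∈-++⁺ˡ p)
∈-envNames ((x , t) ∷ E) (there c∈) p = there (∈-++⁺ʳ (names t) (∈-envNames E c∈ p))

∈-stateNames : ∀ {y c} B P E → c ∈ components P ++ envTerms E → y ∈ names c → y ∈ stateNames (st B P E)
∈-stateNames B P E c∈ p with ∈-++⁻ (components P) c∈
... | inj₁ c∈P = ∈-++⁺ʳ (mcNames B) (∈-++⁺ˡ (∈-jobNames P c∈P p))
... | inj₂ c∈E = ∈-++⁺ʳ (mcNames B) (∈-++⁺ʳ (concatL (map jobNamesOcc P)) (∈-envNames E c∈E p))

lookupEnv-names : ∀ B P E {x t} → lookupEnv E x ≡ just t → ∀ {y} → y ∈ names t → y ∈ stateNames (st B P E)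
lookupEnv-names B P E found = ∈-stateNames B P E (∈-++⁺ʳ (components P) (lookupEnv-∈ E found))

record Invariant (s : State) : Set where
  constructor invariant
  field
    approx : Approx (State.appr s)
    holes-unique : Unique (mcHoles (State.appr s))
    well-bound : WellBound (components (State.jobs s)) (envTerms (State.env s))

WellBound-refocus : ∀ P₁ j P₂ j' {es es'} → WellBound (components (P₁ ++ j ∷ P₂)) es →
  (WellBound (jobTerms j ++ components (P₁ ++ P₂)) es → WellBound (jobTerms j' ++ components (P₁ ++ P₂)) es') →
  WellBound (components (P₁ ++ j' ∷ P₂)) es'
WellBound-refocus P₁ j P₂ j' wb f =
  WellBound-resp-↭ (↭-sym (components-focus P₁ j' P₂)) (f (WellBound-resp-↭ (components-focus P₁ j P₂) wb))

components-zip : ∀ S βs → length βs ≡ length S → components (zipWith (λ t β → job t [] β) S βs) ≡ S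
components-zip [] [] _ = refl
components-zip (t ∷ S) (β ∷ βs) eq = cong (t ∷_) (components-zip S βs (suc-injective eq))

Invariant-step : ∀ {s k s'} → Invariant s → s ⇒[ k ] s' → Invariant s'
Invariant-step (invariant A uh wb) (t-seaApp {P₁ = P₁} {P₂}) = invariant A uh (WellBound-refocus P₁ _ P₂ _ wb WellBound-app)
Invariant-step (invariant A uh wb) (t-beta {P₁ = P₁} {P₂} {u = u}) =
  invariant A uh (WellBound-refocus P₁ _ P₂ _ wb λ w → WellBound-unbind (u ∷ []) w (λ c∈ → c∈))
Invariant-step (invariant A uh wb) (t-sub {B} {P₁} {P₂} {E} {x} {S} {α} {t₀} {t'} le wn t'≈t₀ fresh) =
  invariant A uh (WellBound-refocus P₁ _ P₂ _ wb λ w → WellBound-rename w (lookupEnv-∈ E le) t'≈t₀ (proj₁ wn) fresh')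
  where
  P = P₁ ++ job (v x) S α ∷ P₂
  fresh' : ∀ {y c} → y ∈ bv t' → c ∈ (S ++ components (P₁ ++ P₂)) ++ envTerms E → y ∉ names c
  fresh' y∈ c∈ y∈c = All.lookup fresh y∈
    (∈-stateNames B P E (∈-resp-↭ (++⁺ʳ (envTerms E) (↭-sym (components-focus P₁ (job (v x) S α) P₂))) (there c∈)) y∈c)
Invariant-step (invariant A uh wb) (t-seaLam {B} {P₁} {P₂} {x = x} {α = α}) = invariant
  (Approx-replace α (lam x (hole α)) A)
  (Unique-holes-replace B uh (All.[] ∷ []) λ { (here refl) _ → refl })
  (WellBound-refocus P₁ _ P₂ _ wb λ w → WellBound-unbind [] w (λ c∈ → c∈))
Invariant-step (invariant A uh wb) (t-seaVar {B} {P₁} {P₂} {E} {x} {S} {α} βs _ len uβ fresh) = invariant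
  (Approx-replace α (rigid (RigidApprox-varCtx x βs)) A)
  (Unique-holes-replace B uh (subst Unique (sym (holes-varCtx x βs)) uβ) λ {β} β∈C β∈B →
    ⊥-elim (All.lookup fresh (subst (β ∈_) (holes-varCtx x βs) β∈C) (∈-++⁺ˡ β∈B)))
  (WellBound-resp-↭ (↭-sym spawned) (WellBound-drop-var (WellBound-resp-↭ (components-focus P₁ _ P₂) wb)))
  where
  Z = zipWith (λ t β → job t [] β) S βs
  spawned : components (P₁ ++ Z ++ P₂) ↭ S ++ components (P₁ ++ P₂)
  spawned = ↭-trans (concatMap-↭ jobTerms (shifts P₁ Z))
    (↭-reflexive (trans (concatMap-++ jobTerms Z (P₁ ++ P₂)) (cong (_++ components (P₁ ++ P₂)) (components-zip S βs len))))

Invariant-initial : ∀ t α → WellNamed t → Invariant (st (mhole α) (job t [] α ∷ []) [])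
Invariant-initial t α (uniq , not-free) = invariant (hole α) (All.[] ∷ []) (mkWellBound
  (subst Unique (sym (++-identityʳ (bv t))) uniq)
  λ { {x} x∈ (here refl) → not-free x (subst (x ∈_) (++-identityʳ (bv t)) x∈) })

Invariant-reachable : ∀ {s} → Reachable s → Invariant s
Invariant-reachable (t , α , wn , steps) = go (Invariant-initial t α wn) steps
  where
  go : ∀ {s s'} → Invariant s → Star AnyStep s s' → Invariant s'
  go inv ε = inv
  go inv ((_ , step) ◅ steps) = go (Invariant-step inv step) steps

range : ℕ → ℕ → List ℕ
range c zero = []
range c (suc n) = c ∷ range (suc c) n

range-++ : ∀ c m n → range c (m + n) ≡ range c m ++ range (c + m) n
range-++ c zero n rewrite +-identityʳ c = refl
range-++ c (suc m) n rewrite +-suc c m = cong (c ∷_) (range-++ (suc c) m n)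

range-≥ : ∀ {y} c n → y ∈ range c n → c ≤ y
range-≥ c (suc n) (here refl) = ≤-refl
range-≥ c (suc n) (there p) = <⇒≤ (range-≥ (suc c) n p)

range-unique : ∀ c n → Unique (range c n)
range-unique c zero = []
range-unique c (suc n) = All.tabulate (λ p → <⇒≢ (range-≥ (suc c) n p)) ∷ range-unique (suc c) n

range-length : ∀ c n → length (range c n) ≡ n
range-length c zero = refl
range-length c (suc n) = cong suc (range-length (suc c) n)

above-max : (N : List ℕ) → ∀ {y} → suc (max 0 N) ≤ y → y ∉ N
above-max N ≤y y∈N = <⇒≱ (s≤s (All.lookup (xs≤max 0 N) y∈N)) ≤y

fresh-names : ∀ (N : List ℕ) n → ∃ λ βs → length βs ≡ n × Unique βs × All (_∉ N) βs
fresh-names N n = range m n , range-length m n , range-unique m n , All.tabulate (λ p → above-max N (range-≥ m n p))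
  where m = suc (max 0 N)

binders : PTm → ℕ
binders (v _) = 0
binders (ƛ _ t) = suc (binders t)
binders (t · u) = binders t + binders u

_[_↦_] : (Name → Name) → Name → Name → Name → Name
(ρ [ y ↦ c ]) z = if z ≡ᵇ y then c else ρ z

relabel : ℕ → (Name → Name) → PTm → PTm
relabel c ρ (v y) = v (ρ y)
relabel c ρ (ƛ y t) = ƛ c (relabel (suc c) (ρ [ y ↦ c ]) t)
relabel c ρ (t · u) = relabel c ρ t · relabel (c + binders t) ρ u

bv-relabel : ∀ c ρ t → bv (relabel c ρ t) ≡ range c (binders t)
bv-relabel c ρ (v y) = refl
bv-relabel c ρ (ƛ y t) = cong (c ∷_) (bv-relabel (suc c) (ρ [ y ↦ c ]) t)
bv-relabel c ρ (t · u) rewrite bv-relabel c ρ t | bv-relabel (c + binders t) ρ u = sym (range-++ c (binders t) (binders u))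

conv-relabel : ∀ t {c ρ Γ Γ' m} → m ≤ c → (∀ {y} → y < m → ρ y < c) →
  (∀ {y} → y < m → lookupIdx Γ' (ρ y) ≡ lookupIdx Γ y) → All (_< m) (names t) → conv Γ' (relabel c ρ t) ≡ conv Γ t
conv-relabel (v y) m≤c ρ<c ρ-lookup (y<m ∷ _) = cong var (ρ-lookup y<m)
conv-relabel (ƛ y t) {c} {ρ} {Γ} {Γ'} {m} m≤c ρ<c ρ-lookup (_ ∷ t<m) =
  cong lam (conv-relabel t (m≤n⇒m≤1+n m≤c) ρ'<c ρ'-lookup t<m)
  where
  ρ'<c : ∀ {z} → z < m → (ρ [ y ↦ c ]) z < suc c
  ρ'<c {z} z<m with z ≟ y
  ... | yes refl rewrite ≡ᵇ-refl z = ≤-refl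
  ... | no z≢y rewrite ≡ᵇ-false z≢y = m<n⇒m<1+n (ρ<c z<m)
  ρ'-lookup : ∀ {z} → z < m → lookupIdx (c ∷ Γ') ((ρ [ y ↦ c ]) z) ≡ lookupIdx (y ∷ Γ) z
  ρ'-lookup {z} z<m with z ≟ y
  ... | yes refl rewrite ≡ᵇ-refl z | ≡ᵇ-refl c = refl
  ... | no z≢y rewrite ≡ᵇ-false z≢y | ≡ᵇ-false (<⇒≢ (ρ<c z<m)) = cong suc (ρ-lookup z<m)
conv-relabel (t · u) {c} {m = m} m≤c ρ<c ρ-lookup tu<m =
  cong₂ app (conv-relabel t m≤c ρ<c ρ-lookup (All.++⁻ˡ (names t) tu<m))
            (conv-relabel u (≤-trans m≤c (m≤m+n c (binders t))) (λ y<m → <-≤-trans (ρ<c y<m) (m≤m+n c (binders t)))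
                          ρ-lookup (All.++⁻ʳ (names t) tu<m))

fresh-renaming : ∀ (N : List Name) t → (∀ {y} → y ∈ names t → y ∈ N) →
  ∃ λ t' → WellNamed t' × ⟦ t' ⟧ ≡ ⟦ t ⟧ × All (_∉ N) (bv t')
fresh-renaming N t names⊆N = t' , (unique , not-free) , t'≈t , fresh
  where
  m = suc (max 0 N)
  t' = relabel m (λ y → y) t
  t'≈t : ⟦ t' ⟧ ≡ ⟦ t ⟧
  t'≈t = conv-relabel t ≤-refl (λ y<m → y<m) (λ _ → refl)
           (All.tabulate λ y∈t → s≤s (All.lookup (xs≤max 0 N) (names⊆N y∈t)))
  fresh : All (_∉ N) (bv t')
  fresh = All.tabulate λ y∈t' → above-max N (range-≥ m (binders t) (subst (_ ∈_) (bv-relabel m (λ y → y) t) y∈t'))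
  unique : Unique (bv t')
  unique = subst Unique (sym (bv-relabel m (λ y → y) t)) (range-unique m (binders t))
  not-free : ∀ y → y ∈ bv t' → ¬ FreeIn y t'
  not-free y y∈t' p = All.lookup fresh y∈t' (names⊆N (FreeIn⇒∈names t (FreeIn-resp-α t'≈t p)))

-- The β transition

data RedexJob : Job → Set where
  redex : ∀ x t u S α → RedexJob (job (ƛ x t) (u ∷ S) α)

OverheadFree : State → Set
OverheadFree s = ∀ (k : Kind) (s' : State) → Overhead k → ¬ (s ⇒[ k ] s')

overhead-free-redex : ∀ {B P₁ j P₂ E} → OverheadFree (st B (P₁ ++ j ∷ P₂) E) → RedexJob j
overhead-free-redex {j = job (t · u) S α} free = ⊥-elim (free kSeaApp _ (λ ()) t-seaApp)
overhead-free-redex {j = job (ƛ x t) [] α} free = ⊥-elim (free kSeaLam _ (λ ()) t-seaLam)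
overhead-free-redex {j = job (ƛ x t) (u ∷ S) α} free = redex x t u S α
overhead-free-redex {B} {P₁} {job (v x) S α} {P₂} {E} free with lookupEnv E x in found
... | just t₀ with fresh-renaming (stateNames (st B (P₁ ++ job (v x) S α ∷ P₂) E)) t₀
                    (lookupEnv-names B (P₁ ++ job (v x) S α ∷ P₂) E found)
...   | t' , wn , t'≈t₀ , fresh = ⊥-elim (free kSub _ (λ ()) (t-sub found wn t'≈t₀ fresh))
overhead-free-redex {B} {P₁} {job (v x) S α} {P₂} {E} free | nothing
  with fresh-names (stateJobNames (st B (P₁ ++ job (v x) S α ∷ P₂) E)) (length S)
... | βs , len , uniq , fresh = ⊥-elim (free kSeaVar _ (λ ()) (t-seaVar βs found len uniq fresh))

rbJob-fresh : ∀ {x} u E j → (∀ {c} → c ∈ jobTerms j → ¬ FreeIn x c) → rbJob ((x , u) ∷ E) j ≡ rbJob E j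
rbJob-fresh u E (job t S α) x∉j =
  cong₂ plugStack (downTm-fresh t u E (x∉j (here refl))) (downTms-fresh S u E (λ c∈ → x∉j (there c∈)))

rbJobs-fresh : ∀ {x} u E Q → (∀ {c} → c ∈ components Q → ¬ FreeIn x c) →
  All (λ i → rbJob ((x , u) ∷ E) i ≡ rbJob E i) Q
rbJobs-fresh u E [] _ = []
rbJobs-fresh u E (i ∷ Q) x∉ =
  rbJob-fresh u E i (λ c∈ → x∉ (∈-++⁺ˡ c∈)) ∷ rbJobs-fresh u E Q (λ c∈ → x∉ (∈-++⁺ʳ (jobTerms i) c∈))

rbJob-β : ∀ {x t u S α E} → (∀ {c} → c ∈ S → ¬ FreeIn x c) →
  rbJob E (job (ƛ x t) (u ∷ S) α) →ₕ rbJob ((x , u) ∷ E) (job t S α)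
rbJob-β {x} {t} {u} {S} {α} {E} x∉S =
  subst₂ _→ₕ_ (cong (λ H → plugStack (app H N) args) (sym (downTm-lam x t E)))
              (cong₂ plugStack (sym (downTm-β x ⟦ t ⟧ ⟦ u ⟧ E)) (sym (downTms-fresh S u E x∉S)))
              (plugStack-→ₕ args (β-head (downTmUnder 1 (close x 0 ⟦ t ⟧) E) N))
  where
  N = downTm ⟦ u ⟧ E
  args = map (λ w → downTm ⟦ w ⟧ E) S

data FirstJob (E : Env) (α : JName) (T : Tm) : List Job → Set where
  first : ∀ P₁ j P₂ → All (λ i → Job.nm i ≢ α) P₁ → Job.nm j ≡ α → rbJob E j ≡ T →
    FirstJob E α T (P₁ ++ j ∷ P₂)

lookupJob-first : ∀ E P α {T} → lookupJob E P α ≡ just T → FirstJob E α T P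
lookupJob-first E (i ∷ P) α found with Job.nm i ≟ α
... | yes refl rewrite ≡ᵇ-refl (Job.nm i) = first [] i P [] refl (just-injective found)
... | no i≢α rewrite ≡ᵇ-false i≢α with lookupJob-first E P α found
...   | first P₁ j P₂ skip j≡α found-j = first (i ∷ P₁) j P₂ (i≢α ∷ skip) j≡α found-j

lookupJob-skip : ∀ E P₁ {j P₂ α} → All (λ i → Job.nm i ≢ α) P₁ → Job.nm j ≡ α →
  lookupJob E (P₁ ++ j ∷ P₂) α ≡ just (rbJob E j)
lookupJob-skip E [] {j} [] refl rewrite ≡ᵇ-refl (Job.nm j) = refl
lookupJob-skip E (i ∷ P₁) (i≢α ∷ skip) j≡α rewrite ≡ᵇ-false i≢α = lookupJob-skip E P₁ skip j≡α

lookupJob-other : ∀ E P₁ {j P₂ β} → Job.nm j ≢ β → lookupJob E (P₁ ++ j ∷ P₂) β ≡ lookupJob E (P₁ ++ P₂) β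
lookupJob-other E [] j≢β rewrite ≡ᵇ-false j≢β = refl
lookupJob-other E (i ∷ P₁) {β = β} j≢β with Job.nm i ≡ᵇ β
... | true = refl
... | false = lookupJob-other E P₁ j≢β

lookupJob-cong : ∀ {E E' β} P → All (λ i → rbJob E' i ≡ rbJob E i) P → lookupJob E' P β ≡ lookupJob E P β
lookupJob-cong [] [] = refl
lookupJob-cong {β = β} (i ∷ P) (same ∷ stable) with Job.nm i ≡ᵇ β
... | true = cong just same
... | false = lookupJob-cong P stable

lookupJob-replace : ∀ {E E' α} P₁ {P₂} j j' → All (λ i → Job.nm i ≢ α) P₁ → Job.nm j ≡ α → Job.nm j' ≡ α →
  All (λ i → rbJob E' i ≡ rbJob E i) (P₁ ++ P₂) →
  ∀ β → lookupJob E' (P₁ ++ j' ∷ P₂) β ≡ update (lookupJob E (P₁ ++ j ∷ P₂)) α (rbJob E' j') β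
lookupJob-replace {E} {E'} {α} P₁ {P₂} j j' skip j≡α j'≡α stable β with β ≟ α
... | yes refl = trans (lookupJob-skip E' P₁ skip j'≡α) (sym (update-≡ (lookupJob E (P₁ ++ j ∷ P₂)) β (rbJob E' j')))
... | no β≢α = begin
  lookupJob E' (P₁ ++ j' ∷ P₂) β  ≡⟨ lookupJob-other E' P₁ (λ j'≡β → β≢α (trans (sym j'≡β) j'≡α)) ⟩
  lookupJob E' (P₁ ++ P₂) β       ≡⟨ lookupJob-cong (P₁ ++ P₂) stable ⟩
  lookupJob E (P₁ ++ P₂) β        ≡⟨ sym (lookupJob-other E P₁ (λ j≡β → β≢α (trans (sym j≡β) j≡α))) ⟩
  lookupJob E (P₁ ++ j ∷ P₂) β    ≡⟨ sym (update-≢ (lookupJob E (P₁ ++ j ∷ P₂)) α (rbJob E' j') β≢α) ⟩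
  update (lookupJob E (P₁ ++ j ∷ P₂)) α (rbJob E' j') β ∎
  where open ≡-Reasoning

β-step-readback : ∀ {B P₁ P₂ E x t u S α T' w} → Invariant (st B (P₁ ++ job (ƛ x t) (u ∷ S) α ∷ P₂) E) →
  All (λ i → Job.nm i ≢ α) P₁ → rbJob E (job (ƛ x t) (u ∷ S) α) →ext T' →
  fill (update (lookupJob E (P₁ ++ job (ƛ x t) (u ∷ S) α ∷ P₂)) α T') B ≡ just w →
  rb (st B (P₁ ++ job t S α ∷ P₂) ((x , u) ∷ E)) ≡ just w
β-step-readback {B} {P₁} {P₂} {E} {x} {t} {u} {S} {α} {T'} inv skip step refilled =
  trans (fill-cong B λ {β} _ → trans (lookupJob-replace P₁ j j' skip refl refl stable β)
                                       (cong (λ T → update f α T β) (sym contracted)))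
        refilled
  where
  j = job (ƛ x t) (u ∷ S) α
  j' = job t S α
  f = lookupJob E (P₁ ++ j ∷ P₂)
  x-fresh : ∀ {c} → c ∈ S ++ components (P₁ ++ P₂) → ¬ FreeIn x c
  x-fresh c∈ = WellBound.not-free (WellBound-resp-↭ (components-focus P₁ j P₂) (Invariant.well-bound inv))
                 (here refl) (there (there (∈-++⁺ˡ c∈)))
  contracted : T' ≡ rbJob ((x , u) ∷ E) j'
  contracted = →ext-head (rbJob-β {x} {t} {u} {S} {α} {E} (λ c∈ → x-fresh (∈-++⁺ˡ c∈))) step
  stable : All (λ i → rbJob ((x , u) ∷ E) i ≡ rbJob E i) (P₁ ++ P₂)
  stable = rbJobs-fresh u E (P₁ ++ P₂) (λ c∈ → x-fresh (∈-++⁺ʳ S c∈))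

proposition9 : (s : State) → Reachable s →
    (∀ (k : Kind) (s' : State) → Overhead k → ¬ (s ⇒[ k ] s')) →
    ∀ (t u : Tm) → rb s ≡ just t → t →ext u →
    ∃ λ s' → (s ⇒[ kBeta ] s') × rb s' ≡ just u
proposition9 (st B P E) reachable overhead-free t u rb≡t step with Invariant-reachable reachable
... | inv@(invariant approx holes-unique _) with approx-step approx holes-unique (lookupJob E P) rb≡t step
... | hole-step α _ found stepα refilled with lookupJob-first E P α found
... | first P₁ j P₂ skip refl refl with overhead-free-redex {j = j} overhead-free
... | redex _ _ _ _ _ = _ , t-beta , β-step-readback inv skip stepα refilled
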